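{- Let $G$ be a finite graph and $k\ge 0$ an integer such that $G$ has at least one closed set of size $k$. Then \[ \phi_k(G)=\min\{\chi(G/X) : X\subseteq E(G) \text{ is a closed set with } |X|=k\}. \]
   Context: For $X\subseteq E(G)$, the rank $r(X)$ is the number of vertices of $G$ minus the number of connected components of the spanning subgraph $(V(G),X)$. A set $X\subseteq E(G)$ is closed if $r(X\cup\{e\})>r(X)$ for every edge $e\in E(G)\setminus X$ (equivalently, no edge outside $X$ joins two vertices lying in the same component of $(V(G),X)$). $G/X$ denotes the graph obtained from $G$ by contracting all edges of $X$, and $\chi$ denotes the chromatic number. For a vertex coloring $c:V(G)\to\{1,\dots,\ell\}$ (not required to be proper or surjective), an edge $uv$ is bad if $c(u)=c(v)$; the $k$-defect number $\phi_k(G)$ is the smallest positive integer $\ell$ such that some coloring $c:V(G)\to\{1,\dots,\ell\}$ has exactly $k$ bad edges (and $\phi_k(G)=0$ if no coloring has exactly $k$ bad edges). -}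

module Defs where

open import Data.Nat using (ℕ; zero; suc; _+_; _≤_)
open import Data.Fin using (Fin; zero; suc)
open import Data.Fin.Subset using (Subset; _∈_; _∉_; ∣_∣)
open import Data.Product using (Σ; _×_; _,_; proj₁; proj₂)
open import Data.Sum using (_⊎_)
open import Data.Empty using (⊥)
open import Relation.Binary.PropositionalEquality using (_≡_; _≢_)
open import Relation.Nullary using (yes; no)
open import Data.Fin using (_≟_)

-- A finite (multi)graph: vertices Fin nV, edges Fin nE, each edge has two
-- endpoints (loops and parallel edges allowed; simple graphs are a special case).
record Graph : Set where
  field
    nV   : ℕ
    nE   : ℕ
    ends : Fin nE → Fin nV × Fin nV

open Graph public

Joins : (G : Graph) → Fin (nE G) → Fin (nV G) → Fin (nV G) → Set
Joins G e u v = (proj₁ (ends G e) ≡ u × proj₂ (ends G e) ≡ v)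
              ⊎ (proj₁ (ends G e) ≡ v × proj₂ (ends G e) ≡ u)

data Conn (G : Graph) (X : Subset (nE G)) : Fin (nV G) → Fin (nV G) → Set where
  here : ∀ {u} → Conn G X u u
  step : ∀ {u v w} (e : Fin (nE G)) → Conn G X u v → e ∈ X → Joins G e v w → Conn G X u w

Closed : (G : Graph) → Subset (nE G) → Set
Closed G X = ∀ e → e ∉ X → Conn G X (proj₁ (ends G e)) (proj₂ (ends G e)) → ⊥

-- A proper ℓ-colouring of G/X: the vertices of G/X are the components of (V(G),X),
-- so a colouring of G/X is a colouring of V(G) constant on these components; the
-- edges of G/X are the edges of G outside X (joining the corresponding components),
-- and it is proper when their endpoints get different colours.
ProperColouringContr : (G : Graph) → Subset (nE G) → (ℓ : ℕ) → (Fin (nV G) → Fin ℓ) → Set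
ProperColouringContr G X ℓ c =
  (∀ u v → Conn G X u v → c u ≡ c v) ×
  (∀ e → e ∉ X → c (proj₁ (ends G e)) ≢ c (proj₂ (ends G e)))

ChromContr : (G : Graph) → Subset (nE G) → ℕ → Set
ChromContr G X ℓ =
  Σ (Fin (nV G) → Fin ℓ) (ProperColouringContr G X ℓ) ×
  (∀ ℓ' (c : Fin (nV G) → Fin ℓ') → ProperColouringContr G X ℓ' c → ℓ ≤ ℓ')

countBad' : (G : Graph) {ℓ : ℕ} → (Fin (nV G) → Fin ℓ) → (k : ℕ) → (Fin k → Fin (nE G)) → ℕ
countBad' G c zero    f = 0
countBad' G c (suc k) f with c (proj₁ (ends G (f zero))) ≟ c (proj₂ (ends G (f zero)))
... | yes _ = suc (countBad' G c k (λ i → f (suc i)))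
... | no  _ = countBad' G c k (λ i → f (suc i))

badEdges : (G : Graph) {ℓ : ℕ} → (Fin (nV G) → Fin ℓ) → ℕ
badEdges G c = countBad' G c (nE G) (λ e → e)

DefectNumber : (G : Graph) → ℕ → ℕ → Set
DefectNumber G k ℓ =
  1 ≤ ℓ ×
  Σ (Fin (nV G) → Fin ℓ) (λ c → badEdges G c ≡ k) ×
  (∀ ℓ' → 1 ≤ ℓ' → (c : Fin (nV G) → Fin ℓ') → badEdges G c ≡ k → ℓ ≤ ℓ')

MinChromClosed : (G : Graph) → ℕ → ℕ → Set
MinChromClosed G k ℓ =
  Σ (Subset (nE G)) (λ X → Closed G X × ∣ X ∣ ≡ k × ChromContr G X ℓ) ×
  (∀ (X : Subset (nE G)) ℓ' → Closed G X → ∣ X ∣ ≡ k → ChromContr G X ℓ' → ℓ ≤ ℓ')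

-- The bad edges of a colouring c form a closed set M, and c is a proper
-- colouring of G/M; conversely, the bad edges of a proper colouring of G/X are
-- exactly the edges of X.  So an ℓ-colouring with exactly k bad edges is the
-- same thing as a proper ℓ-colouring of G/X for some closed X with |X| = k,
-- and both sides of the identity are the least such ℓ.  Such ℓ exist, since
-- labelling the components of (V(G), X) gives a |V(G)|-colouring whose bad
-- edges are X, and the least one is found by exhaustive search.
module Submission where

open import Defs
open import Data.Nat using (ℕ; zero; suc; _≤_; _<_; _+_; >-nonZero⁻¹)
open import Data.Nat.Properties using (≮⇒≥; +-suc; +-identityʳ; m<1+n⇒m<n∨m≡n)
import Data.Nat.Properties as ℕ
open import Data.Fin using (Fin; zero; suc; _≟_; fromℕ<; finToFun; funToFin)
open import Data.Fin.Properties using (any?; nonZeroIndex; finToFun-funToFin)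
open import Data.Fin.Subset using (Subset; _∈_; _∉_; ∣_∣; inside; outside)
open import Data.Fin.Subset.Properties using (_∈?_; drop-there)
open import Data.Vec using ([]; _∷_; here; there; tabulate)
open import Data.Vec.Properties using ([]=⇒lookup; lookup⇒[]=; lookup∘tabulate)
open import Data.List using (List; []; _∷_; foldr; filter; allFin)
open import Data.List.Relation.Unary.All using (All; []; _∷_)
open import Data.List.Relation.Unary.All.Properties using (all-filter)
import Data.List.Relation.Unary.Any as Any
import Data.List.Membership.Propositional as List
open import Data.List.Membership.Propositional.Properties using (∈-filter⁺; ∈-allFin)
open import Data.Product using (Σ; _×_; _,_; ∃; proj₁; proj₂)
open import Data.Sum using (inj₁; inj₂)
open import Function using (id; _∘_)
open import Relation.Nullary using (¬_; yes; no; does; contradiction)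
open import Relation.Nullary.Decidable using (map′; dec-true)
open import Relation.Unary using (Pred; Decidable)
open import Relation.Binary.PropositionalEquality using (_≡_; _≗_; refl; sym; trans; cong; subst)

Least : ∀ {p} → Pred ℕ p → Pred ℕ p
Least P n = P n × (∀ {m} → P m → n ≤ m)

module _ {p} {P : Pred ℕ p} (P? : Decidable P) where

  least-≥ : ∀ i d → (∀ {j} → j < i → ¬ P j) → P (d + i) → ∃ (Least P)
  least-≥ i d none-below pᵢ₊d with P? i
  ... | yes pᵢ = i , pᵢ , λ pⱼ → ≮⇒≥ (λ j<i → none-below j<i pⱼ)
  least-≥ i zero    none-below pᵢ  | no ¬pᵢ = contradiction pᵢ ¬pᵢ
  least-≥ i (suc d) none-below pᵢ₊d | no ¬pᵢ =
    least-≥ (suc i) d none-up-to-i (subst P (sym (+-suc d i)) pᵢ₊d)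
    where
    none-up-to-i : ∀ {j} → j < suc i → ¬ P j
    none-up-to-i j<1+i with m<1+n⇒m<n∨m≡n j<1+i
    ... | inj₁ j<i  = none-below j<i
    ... | inj₂ refl = ¬pᵢ

  least : ∀ {n} → P n → ∃ (Least P)
  least {n} pₙ = least-≥ 0 n (λ ()) (subst P (sym (+-identityʳ n)) pₙ)

module _ {n p} {P : Pred (Fin n) p} (P? : Decidable P) where

  subsetOf : Subset n
  subsetOf = tabulate (does ∘ P?)

  ∈-subsetOf⁺ : ∀ {x} → P x → x ∈ subsetOf
  ∈-subsetOf⁺ {x} Px = lookup⇒[]= x subsetOf (trans (lookup∘tabulate _ x) (dec-true (P? x) Px))

  ∈-subsetOf⁻ : ∀ {x} → x ∈ subsetOf → P x
  ∈-subsetOf⁻ {x} x∈ with P? x | trans (sym (lookup∘tabulate (does ∘ P?) x)) ([]=⇒lookup x∈)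
  ... | yes Px | _  = Px
  ... | no _   | ()

identify : ∀ {n} → Fin n → Fin n → Fin n → Fin n
identify a b x with x ≟ b
... | yes _ = a
... | no _  = x

identify-target : ∀ {n} (a b : Fin n) → identify a b b ≡ a
identify-target a b with b ≟ b
... | yes _   = refl
... | no b≢b = contradiction refl b≢b

identify-source : ∀ {n} (a b : Fin n) → identify a b a ≡ a
identify-source a b with a ≟ b
... | yes _ = refl
... | no _  = refl

end₁ end₂ : (G : Graph) → Fin (nE G) → Fin (nV G)
end₁ G e = proj₁ (ends G e)
end₂ G e = proj₂ (ends G e)

module _ {G : Graph} {X : Subset (nE G)} where

  Joins-sym : ∀ {e v w} → Joins G e v w → Joins G e w v
  Joins-sym (inj₁ ends≡) = inj₂ ends≡
  Joins-sym (inj₂ ends≡) = inj₁ ends≡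

  Conn-trans : ∀ {u v w} → Conn G X u v → Conn G X v w → Conn G X u w
  Conn-trans p here             = p
  Conn-trans p (step e q e∈X j) = step e (Conn-trans p q) e∈X j

  Conn-sym : ∀ {u v} → Conn G X u v → Conn G X v u
  Conn-sym here             = here
  Conn-sym (step e p e∈X j) = Conn-trans (step e here e∈X (Joins-sym j)) (Conn-sym p)

  Conn-edge : ∀ {e} → e ∈ X → Conn G X (end₁ G e) (end₂ G e)
  Conn-edge {e} e∈X = step e here e∈X (inj₁ (refl , refl))

module _ (G : Graph) where

  private
    V = nV G
    E = nE G

  Monochromatic : ∀ {ℓ} → (Fin V → Fin ℓ) → Pred (Fin E) _
  Monochromatic c e = c (end₁ G e) ≡ c (end₂ G e)

  monochromatic? : ∀ {ℓ} (c : Fin V → Fin ℓ) → Decidable (Monochromatic c)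
  monochromatic? c e = c (end₁ G e) ≟ c (end₂ G e)

  monochromaticEdges : ∀ {ℓ} → (Fin V → Fin ℓ) → Subset E
  monochromaticEdges c = subsetOf (monochromatic? c)

  module _ {ℓ} (c : Fin V → Fin ℓ) where

    countBad'≡∣∣ : ∀ k (f : Fin k → Fin E) (Y : Subset k) →
                   (∀ i → i ∈ Y → Monochromatic c (f i)) →
                   (∀ i → i ∉ Y → ¬ Monochromatic c (f i)) →
                   countBad' G c k f ≡ ∣ Y ∣
    countBad'≡∣∣ zero    f []      _    _     = refl
    countBad'≡∣∣ (suc k) f (s ∷ Y) mono ¬mono with monochromatic? c (f zero) | s
    ... | yes _  | inside  = cong suc (countBad'≡∣∣ k (f ∘ suc) Y (λ i → mono (suc i) ∘ there)
                                                         (λ i i∉Y → ¬mono (suc i) (i∉Y ∘ drop-there)))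
    ... | no _   | outside = countBad'≡∣∣ k (f ∘ suc) Y (λ i → mono (suc i) ∘ there)
                                               (λ i i∉Y → ¬mono (suc i) (i∉Y ∘ drop-there))
    ... | yes m  | outside = contradiction m (¬mono zero λ ())
    ... | no ¬m  | inside  = contradiction (mono zero here) ¬m

    badEdges≡∣∣ : (Y : Subset E) → (∀ e → e ∈ Y → Monochromatic c e) →
                  (∀ e → e ∉ Y → ¬ Monochromatic c e) → badEdges G c ≡ ∣ Y ∣
    badEdges≡∣∣ = countBad'≡∣∣ E id

    badEdges≡∣monochromaticEdges∣ : badEdges G c ≡ ∣ monochromaticEdges c ∣
    badEdges≡∣monochromaticEdges∣ = badEdges≡∣∣ (monochromaticEdges c)
      (λ _ → ∈-subsetOf⁻ (monochromatic? c)) (λ _ e∉ → e∉ ∘ ∈-subsetOf⁺ (monochromatic? c))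

  Monochromatic-cong : ∀ {ℓ} {c c′ : Fin V → Fin ℓ} → c ≗ c′ → ∀ {e} → Monochromatic c e → Monochromatic c′ e
  Monochromatic-cong c≗c′ m = trans (sym (c≗c′ _)) (trans m (c≗c′ _))

  badEdges-cong : ∀ {ℓ} {c c′ : Fin V → Fin ℓ} → c ≗ c′ → badEdges G c ≡ badEdges G c′
  badEdges-cong {c = c} {c′} c≗c′ = trans (badEdges≡∣monochromaticEdges∣ c) (sym (badEdges≡∣∣ c′ _
    (λ _ → Monochromatic-cong c≗c′ ∘ ∈-subsetOf⁻ (monochromatic? c))
    (λ _ e∉ → e∉ ∘ ∈-subsetOf⁺ (monochromatic? c) ∘ Monochromatic-cong (sym ∘ c≗c′))))

  DefectColourable : ℕ → ℕ → Set
  DefectColourable k ℓ = Σ (Fin V → Fin ℓ) (λ c → badEdges G c ≡ k)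

  -- Colourings are enumerated as Fin (ℓ ^ |V|); badEdges-cong makes this exhaustive.
  defectColourable? : ∀ k → Decidable (DefectColourable k)
  defectColourable? k ℓ = map′
    (λ (i , bad≡k) → finToFun i , bad≡k)
    (λ (c , bad≡k) → funToFin c , trans (badEdges-cong (finToFun-funToFin c)) bad≡k)
    (any? λ i → badEdges G (finToFun {ℓ} {V} i) ℕ.≟ k)

  module _ {Y : Subset E} where

    constant-on-components : ∀ {ℓ} {c : Fin V → Fin ℓ} → (∀ e → e ∈ Y → Monochromatic c e) →
                             ∀ {u v} → Conn G Y u v → c u ≡ c v
    constant-on-components mono here = refl
    constant-on-components mono (step e p e∈Y (inj₁ (refl , refl))) =
      trans (constant-on-components mono p) (mono e e∈Y)
    constant-on-components mono (step e p e∈Y (inj₂ (refl , refl))) =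
      trans (constant-on-components mono p) (sym (mono e e∈Y))

    proper⇒badEdges≡∣∣ : ∀ {ℓ c} → ProperColouringContr G Y ℓ c → badEdges G c ≡ ∣ Y ∣
    proper⇒badEdges≡∣∣ {c = c} (const , proper) =
      badEdges≡∣∣ c Y (λ _ e∈Y → const _ _ (Conn-edge e∈Y)) proper

  module _ {ℓ} (c : Fin V → Fin ℓ) where

    private
      constant : ∀ {u v} → Conn G (monochromaticEdges c) u v → c u ≡ c v
      constant = constant-on-components (λ _ → ∈-subsetOf⁻ (monochromatic? c))

    monochromaticEdges-closed : Closed G (monochromaticEdges c)
    monochromaticEdges-closed e e∉M conn = e∉M (∈-subsetOf⁺ (monochromatic? c) (constant conn))

    proper-monochromaticEdges : ProperColouringContr G (monochromaticEdges c) ℓ c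
    proper-monochromaticEdges = (λ _ _ → constant) , (λ _ e∉M → e∉M ∘ ∈-subsetOf⁺ (monochromatic? c))

  merge : (Fin V → Fin V) → Fin E → Fin V → Fin V
  merge c e = identify (c (end₁ G e)) (c (end₂ G e)) ∘ c

  label : List (Fin E) → Fin V → Fin V
  label = foldr (λ e c → merge c e) id

  merge-monochromatic : ∀ c e → Monochromatic (merge c e) e
  merge-monochromatic c e = trans (identify-source a b) (sym (identify-target a b))
    where
    a b : Fin V
    a = c (end₁ G e)
    b = c (end₂ G e)

  label-monochromatic : ∀ {e es} → e List.∈ es → Monochromatic (label es) e
  label-monochromatic {e} {_ ∷ es} (Any.here refl) = merge-monochromatic (label es) e
  label-monochromatic {_} {e ∷ es} (Any.there e′∈es) =
    cong (identify (label es (end₁ G e)) (label es (end₂ G e))) (label-monochromatic e′∈es)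

  SeparatesComponents : Subset E → (Fin V → Fin V) → Set
  SeparatesComponents X c = ∀ {u w} → c u ≡ c w → Conn G X u w

  merge-separates : ∀ {X c e} → e ∈ X → SeparatesComponents X c → SeparatesComponents X (merge c e)
  merge-separates {c = c} {e} e∈X sep {u} {w} eq with c u ≟ c (end₂ G e) | c w ≟ c (end₂ G e)
  ... | yes u↦b | yes w↦b = sep (trans u↦b (sym w↦b))
  ... | no _    | no _    = sep eq
  ... | yes u↦b | no _    = Conn-trans (Conn-trans (sep u↦b) (Conn-sym (Conn-edge e∈X))) (sep eq)
  ... | no _    | yes w↦b = Conn-trans (Conn-trans (sep eq) (Conn-edge e∈X)) (sep (sym w↦b))

  label-separates : ∀ {X es} → All (_∈ X) es → SeparatesComponents X (label es)
  label-separates []            refl = here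
  label-separates (e∈X ∷ es⊆X) = merge-separates e∈X (label-separates es⊆X)

  closed⇒defectColourable : ∀ {X} → Closed G X → DefectColourable ∣ X ∣ V
  closed⇒defectColourable {X} closed = c , badEdges≡∣∣ c X
    (λ e e∈X → label-monochromatic (∈-filter⁺ (_∈? X) (∈-allFin e) e∈X))
    (λ e e∉X → closed e e∉X ∘ label-separates (all-filter (_∈? X) (allFin E)))
    where
    c : Fin V → Fin V
    c = label (filter (_∈? X) (allFin E))

  least⇒defectNumber×minChromClosed : 1 ≤ V → ∀ {k ℓ} → Least (DefectColourable k) ℓ →
                                      DefectNumber G k ℓ × MinChromClosed G k ℓ
  least⇒defectNumber×minChromClosed 1≤V {k} {ℓ} ((c , bad≡k) , minimal) =
    (1≤ℓ , (c , bad≡k) , λ _ _ c′ bad′≡k → minimal (c′ , bad′≡k)) ,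
    ( (M , monochromaticEdges-closed c , ∣M∣≡k ,
       (c , proper-monochromaticEdges c) , λ _ _ → minimal-proper ∣M∣≡k) ,
      λ _ _ _ ∣Y∣≡k ((_ , proper) , _) → minimal-proper ∣Y∣≡k proper)
    where
    1≤ℓ : 1 ≤ ℓ
    1≤ℓ = >-nonZero⁻¹ ℓ {{nonZeroIndex (c (fromℕ< 1≤V))}}
    M : Subset E
    M = monochromaticEdges c
    ∣M∣≡k : ∣ M ∣ ≡ k
    ∣M∣≡k = trans (sym (badEdges≡∣monochromaticEdges∣ c)) bad≡k
    minimal-proper : ∀ {Y ℓ′ c′} → ∣ Y ∣ ≡ k → ProperColouringContr G Y ℓ′ c′ → ℓ ≤ ℓ′
    minimal-proper ∣Y∣≡k proper = minimal (_ , trans (proper⇒badEdges≡∣∣ proper) ∣Y∣≡k)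

mainTheorem5 : (G : Graph) → 1 ≤ nV G → (k : ℕ) →
    Σ (Subset (nE G)) (λ X → Closed G X × ∣ X ∣ ≡ k) →
    Σ ℕ (λ ℓ → DefectNumber G k ℓ × MinChromClosed G k ℓ)
mainTheorem5 G 1≤V k (X , closed , refl) =
  let ℓ , least-ℓ = least (defectColourable? G ∣ X ∣) (closed⇒defectColourable G closed)
  in  ℓ , least⇒defectNumber×minChromClosed G 1≤V least-ℓ
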